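{- For all $n\geq 1$, $|s_n|>|D_{n-1}|$.
   Context: Fix $k\geq 2$, letters $a_1,\dots,a_k$ and positive integers $(d_i)_{i\geq1}$. Define $s_{1-k}=a_2,\dots,s_{ -1}=a_k,s_0=a_1$; $s_n=s_{n-1}^{d_n}\cdots s_0^{d_1}a_{n+1}$ for $1\leq n\leq k-1$; $s_n=s_{n-1}^{d_n}\cdots s_{n-k+1}^{d_{n-k+2}}s_{n-k}$ for $n\geq k$. Define $D_0=a_1^{d_1-1}$ and $D_m=s_m^{d_{m+1}-1}s_{m-1}^{d_m}\cdots s_1^{d_2}s_0^{d_1}$ for $m\geq1$. -}

module Defs where

open import Data.Nat using (ℕ; zero; suc; _∸_; _+_; _<ᵇ_)
open import Data.Bool using (if_then_else_)
open import Data.List using (List; []; _∷_; _++_; [_]; concat; replicate; drop)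

_^ʷ_ : {A : Set} → List A → ℕ → List A
w ^ʷ e = concat (replicate e w)

headOr : {A : Set} → List (List A) → List A
headOr []      = []
headOr (w ∷ _) = w

tailOr : {A : Set} → List (List A) → List (List A)
tailOr []       = []
tailOr (_ ∷ ws) = ws

module Words {A : Set} (k : ℕ) (a : ℕ → A) (d : ℕ → ℕ) where
  -- a i is the letter a_i (only 1 ≤ i ≤ k is used); d i is d_i (i ≥ 1).

  -- powers c m [w_1, w_2, ...] = w_1^(d m) w_2^(d (m-1)) ... (first c words)
  powers : ℕ → ℕ → List (List A) → List A
  powers zero    m ws       = []
  powers (suc c) m []       = []
  powers (suc c) m (w ∷ ws) = (w ^ʷ d m) ++ powers c (m ∸ 1) ws

  -- step m [s_{m-1}, ..., s_0] = s_m   (for m ≥ 1)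
  step : ℕ → List (List A) → List A
  step m ps =
    if m <ᵇ k
    then powers m m ps ++ [ a (suc m) ]
    else powers (k ∸ 1) m ps ++ headOr (drop (k ∸ 1) ps)

  hist : ℕ → List (List A)
  hist zero    = [ a 1 ] ∷ []
  hist (suc n) = step (suc n) (hist n) ∷ hist n

  s : ℕ → List A
  s n = headOr (hist n)

  -- D m = s_m^(d_{m+1} - 1) s_{m-1}^(d_m) ... s_0^(d_1); D 0 = a_1^(d_1 - 1)
  D : ℕ → List A
  D m = (s m ^ʷ (d (suc m) ∸ 1)) ++ powers m m (tailOr (hist m))

module Submission where

-- Write  P_m = s_m^{d_{m+1}} s_{m-1}^{d_m} ⋯ s_0^{d_1}  for the
-- "full product" of the history up to s_m.  Since D_m is P_m with one copy of
-- s_m removed,  |D_m| + |s_m| = |P_m|.  Now unfold s_{m+1}: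
--   * if m+1 < k, then s_{m+1} = P_m a_{m+2}, so |s_{m+1}| = |P_m| + 1 > |D_m|;
--   * if m+1 ≥ k, then s_{m+1} = Q s_j with j = m+1-k, where Q is the product
--     of the first k-1 powers of P_m, and P_m = Q P_j.  Hence
--       |D_m| + |s_m| = |Q| + |D_j| + |s_j|,
--     and |D_j| < |s_{j+1}| ≤ |s_m| (strong induction and monotonicity of
--     |s_n|, using k ≥ 2), so |D_m| < |Q| + |s_j| = |s_{m+1}|.

open import Defs
open import Data.Nat using (ℕ; zero; suc; _+_; _*_; _∸_; _≤_; _<_; _<ᵇ_; _≤′_; ≤′-refl; ≤′-step; z≤n; s≤s; >-nonZero)
open import Data.Nat.Properties
open import Data.Nat.Induction using (<-rec)
open import Data.List using (List; []; _∷_; _++_; [_]; length; drop)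
open import Data.List.Properties using (length-++; length-++-≤ˡ; ++-assoc)
open import Data.Bool using (true; false)
open import Data.Product using (Σ-syntax; _,_)
open import Relation.Nullary.Reflects using (ofʸ; ofⁿ)
open import Relation.Binary.PropositionalEquality using (_≡_; refl; sym; trans; cong; subst; module ≡-Reasoning)

length-^ʷ : {B : Set} (w : List B) (e : ℕ) → length (w ^ʷ e) ≡ e * length w
length-^ʷ w zero    = refl
length-^ʷ w (suc e) = trans (length-++ w) (cong (length w +_) (length-^ʷ w e))

length-^ʷ-pred : {B : Set} (w : List B) {e : ℕ} → 1 ≤ e → length (w ^ʷ (e ∸ 1)) + length w ≡ length (w ^ʷ e)
length-^ʷ-pred w {suc e} _ = trans (+-comm (length (w ^ʷ e)) (length w)) (sym (length-++ w))

<-by-cancellation : ∀ x y q u v → x + y ≡ q + (u + v) → u < y → x < q + v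
<-by-cancellation x y q u v balance u<y = +-cancelʳ-< y x (q + v) (begin-strict
    x + y         ≡⟨ balance ⟩
    q + (u + v)   <⟨ +-monoʳ-< q (+-monoˡ-< v u<y) ⟩
    q + (y + v)   ≡⟨ cong (q +_) (+-comm y v) ⟩
    q + (v + y)   ≡⟨ sym (+-assoc q v y) ⟩
    q + v + y     ∎)
  where open ≤-Reasoning

module Construction {A : Set} (k₀ : ℕ) (a : ℕ → A) (d : ℕ → ℕ)
                    (d≥1 : ∀ i → 1 ≤ i → 1 ≤ d i) where

  open Words (suc (suc k₀)) a d

  length-head≤powers : ∀ c m (ws : List (List A)) → 1 ≤ d m
                     → length (headOr ws) ≤ length (powers (suc c) m ws)
  length-head≤powers c m []       _   = z≤n
  length-head≤powers c m (w ∷ ws) dm≥1 = begin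
      length w                 ≤⟨ m≤n*m (length w) (d m) {{>-nonZero dm≥1}} ⟩
      d m * length w           ≡⟨ sym (length-^ʷ w (d m)) ⟩
      length (w ^ʷ d m)        ≤⟨ length-++-≤ˡ (w ^ʷ d m) ⟩
      length ((w ^ʷ d m) ++ powers c (m ∸ 1) ws) ∎
    where open ≤-Reasoning

  d-pos : ∀ m → 1 ≤ d (suc m)
  d-pos m = d≥1 (suc m) (s≤s z≤n)

  P : ℕ → List A
  P m = powers (suc m) (suc m) (hist m)

  hist-cons : ∀ m → hist m ≡ s m ∷ tailOr (hist m)
  hist-cons zero    = refl
  hist-cons (suc m) = refl

  drop-hist : ∀ c j → c ≤ j → drop c (hist j) ≡ hist (j ∸ c)
  drop-hist zero    j       _       = refl
  drop-hist (suc c) (suc j) (s≤s p) = drop-hist c j p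

  P-split : ∀ c j → c ≤ j → powers c (suc j) (hist j) ++ P (j ∸ c) ≡ P j
  P-split zero    j       _       = refl
  P-split (suc c) (suc j) (s≤s p) = trans
    (++-assoc (s (suc j) ^ʷ d (suc (suc j))) (powers c (suc j) (hist j)) (P (j ∸ c)))
    (cong (s (suc j) ^ʷ d (suc (suc j)) ++_) (P-split c j p))

  -- D_m is P_m with one copy of s_m removed.
  |D|+|s|≡|P| : ∀ m → length (D m) + length (s m) ≡ length (P m)
  |D|+|s|≡|P| m = begin
      length (D m) + |s|                        ≡⟨ cong (_+ |s|) (length-++ (s m ^ʷ (e ∸ 1))) ⟩
      length (s m ^ʷ (e ∸ 1)) + |R| + |s|       ≡⟨ +-assoc _ |R| |s| ⟩
      length (s m ^ʷ (e ∸ 1)) + (|R| + |s|)     ≡⟨ cong (length (s m ^ʷ (e ∸ 1)) +_) (+-comm |R| |s|) ⟩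
      length (s m ^ʷ (e ∸ 1)) + (|s| + |R|)     ≡⟨ sym (+-assoc _ |s| |R|) ⟩
      length (s m ^ʷ (e ∸ 1)) + |s| + |R|       ≡⟨ cong (_+ |R|) (length-^ʷ-pred (s m) (d-pos m)) ⟩
      length (s m ^ʷ e) + |R|                   ≡⟨ sym (length-++ (s m ^ʷ e)) ⟩
      length (s m ^ʷ e ++ R)                    ≡⟨ cong (λ h → length (powers (suc m) (suc m) h)) (sym (hist-cons m)) ⟩
      length (P m)                              ∎
    where
    open ≡-Reasoning
    e : ℕ
    e = d (suc m)
    R : List A
    R = powers m m (tailOr (hist m))
    |R| |s| : ℕ
    |R| = length R
    |s| = length (s m)

  s-suc-prefix : ∀ m → Σ[ c ∈ ℕ ] Σ[ t ∈ List A ] s (suc m) ≡ powers (suc c) (suc m) (hist m) ++ t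
  s-suc-prefix m with suc m <ᵇ suc (suc k₀)
  ... | true  = m , [ a (suc (suc m)) ] , refl
  ... | false = k₀ , headOr (drop (suc k₀) (hist m)) , refl

  |s|-suc-mono : ∀ m → length (s m) ≤ length (s (suc m))
  |s|-suc-mono m with s-suc-prefix m
  ... | c , t , eq = begin
      length (s m)                                  ≤⟨ length-head≤powers c (suc m) (hist m) (d-pos m) ⟩
      length (powers (suc c) (suc m) (hist m))      ≤⟨ length-++-≤ˡ (powers (suc c) (suc m) (hist m)) ⟩
      length (powers (suc c) (suc m) (hist m) ++ t) ≡⟨ cong length (sym eq) ⟩
      length (s (suc m))                            ∎
    where open ≤-Reasoning

  |s|-mono : ∀ {i j} → i ≤ j → length (s i) ≤ length (s j)
  |s|-mono i≤j = go (≤⇒≤′ i≤j)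
    where
    go : ∀ {i j} → i ≤′ j → length (s i) ≤ length (s j)
    go ≤′-refl                   = ≤-refl
    go {j = suc j} (≤′-step i≤j) = ≤-trans (go i≤j) (|s|-suc-mono j)

  |D|<|s-suc| : ∀ m → length (D m) < length (s (suc m))
  |D|<|s-suc| = <-rec _ step-case
    where
    step-case : ∀ m → (∀ {j} → j < m → length (D j) < length (s (suc j)))
              → length (D m) < length (s (suc m))
    step-case m ih with suc m <ᵇ suc (suc k₀) | <ᵇ-reflects-< (suc m) (suc (suc k₀))
    ... | true | ofʸ _ = begin-strict
        length (D m)                   ≤⟨ m≤m+n (length (D m)) (length (s m)) ⟩
        length (D m) + length (s m)    ≡⟨ |D|+|s|≡|P| m ⟩
        length (P m)                   <⟨ m<m+n (length (P m)) (s≤s z≤n) ⟩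
        length (P m) + 1               ≡⟨ sym (length-++ (P m)) ⟩
        length (P m ++ [ a (suc (suc m)) ]) ∎
      where open ≤-Reasoning
    -- Late case: s_{m+1} = Q s_j with j = m + 1 - k and P_m = Q P_j.
    ... | false | ofⁿ m+1≮k = subst (length (D m) <_) (sym (length-++ Q)) |D|<|Q|+|s-j|
      where
      k-1≤m : suc k₀ ≤ m
      k-1≤m = ≤-pred (≮⇒≥ m+1≮k)
      j : ℕ
      j = m ∸ suc k₀
      Q : List A
      Q = powers (suc k₀) (suc m) (hist m)
      j<m : j < m
      j<m = ∸-monoʳ-< (s≤s z≤n) k-1≤m
      balance : length (D m) + length (s m) ≡ length Q + (length (D j) + length (s j))
      balance = begin
          length (D m) + length (s m)              ≡⟨ |D|+|s|≡|P| m ⟩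
          length (P m)                             ≡⟨ cong length (sym (P-split (suc k₀) m k-1≤m)) ⟩
          length (Q ++ P j)                        ≡⟨ length-++ Q ⟩
          length Q + length (P j)                  ≡⟨ cong (length Q +_) (sym (|D|+|s|≡|P| j)) ⟩
          length Q + (length (D j) + length (s j)) ∎
        where open ≡-Reasoning
      |D-j|<|s-m| : length (D j) < length (s m)
      |D-j|<|s-m| = ≤-trans (ih j<m) (|s|-mono j<m)
      |D|<|Q|+|s-j| : length (D m) < length Q + length (headOr (drop (suc k₀) (hist m)))
      |D|<|Q|+|s-j| rewrite drop-hist (suc k₀) m k-1≤m =
        <-by-cancellation (length (D m)) (length (s m)) (length Q) (length (D j)) (length (s j))
                          balance |D-j|<|s-m|

proposition4p3 : {A : Set} (k : ℕ) → 2 ≤ k → (a : ℕ → A) (d : ℕ → ℕ)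
    → (∀ i → 1 ≤ i → 1 ≤ d i)
    → ∀ n → 1 ≤ n → length (Words.D k a d (n ∸ 1)) < length (Words.s k a d n)
proposition4p3 (suc zero) (s≤s ())
proposition4p3 (suc (suc k₀)) _ a d d≥1 (suc m) _ = Construction.|D|<|s-suc| k₀ a d d≥1 m
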